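{- Let $F_S,F_R,F_{S\otimes R}$ be functors on $\mathbf{Set}$ with maps $\tau_S\colon F_S(\Omega_S)\to\Omega_S$, $\tau_R\colon F_R(\Omega_R)\to\Omega_R$, $\tau_{S\otimes R}\colon F_{S\otimes R}(\Omega_{S\otimes R})\to\Omega_{S\otimes R}$, let $\lambda$ be a distributive law from $F_S$ and $F_R$ to $F_{S\otimes R}$, and let $q\colon\Omega_S\times\Omega_R\to\Omega_{S\otimes R}$ satisfy $q\circ(\tau_S\times\tau_R)=\tau_{S\otimes R}\circ F_{S\otimes R}(q)\circ\lambda_{\Omega_S,\Omega_R}$. Then there is a natural transformation $\tilde\lambda\colon\tilde q\circ\tilde\times\circ(\tilde F_S^{\tau_S}\times\tilde F_R^{\tau_R})\Rightarrow\tilde F_{S\otimes R}^{\tau_{S\otimes R}}\circ\tilde q\circ\tilde\times$ between functors $(\mathbf{Set}/\Omega_S)\times(\mathbf{Set}/\Omega_R)\to\mathbf{Set}/\Omega_{S\otimes R}$ lifting $\lambda$, i.e. with $p_{S\otimes R}(\tilde\lambda_{(u_S,u_R)})=\lambda_{X,Y}$ for all $u_S\colon X\to\Omega_S$, $u_R\colon Y\to\Omega_R$.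
   Context: For a set $\Omega$, the slice category $\mathbf{Set}/\Omega$ has objects maps $u\colon X\to\Omega$ and morphisms $f\colon(u_1\colon X\to\Omega)\to(u_2\colon Y\to\Omega)$ the maps $f\colon X\to Y$ with $u_2\circ f=u_1$; the predicate fibration $p\colon\mathbf{Set}/\Omega\to\mathbf{Set}$ sends $u\colon X\to\Omega$ to $X$ and $f$ to $f$. For a functor $F$ and $\tau\colon F(\Omega)\to\Omega$, the lifting $\tilde F^\tau$ on $\mathbf{Set}/\Omega$ is $\tilde F^\tau(u)=\tau\circ F(u)$, $\tilde F^\tau(g)=F(g)$. The functor $\tilde\times\colon(\mathbf{Set}/\Omega_S)\times(\mathbf{Set}/\Omega_R)\to\mathbf{Set}/(\Omega_S\times\Omega_R)$ is $\tilde\times(u_S,u_R)=u_S\times u_R$ (and $f\times g$ on morphisms), and $\tilde q\colon\mathbf{Set}/(\Omega_S\times\Omega_R)\to\mathbf{Set}/\Omega_{S\otimes R}$ is $\tilde q(u)=q\circ u$ (identity on morphisms). A distributive law from $F_S$ and $F_R$ to $F_{S\otimes R}$ is a family $\lambda_{X,Y}\colon F_S(X)\times F_R(Y)\to F_{S\otimes R}(X\times Y)$ natural in $X,Y$. -}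

module Defs where

open import Data.Product using (_×_; _,_; proj₁; proj₂)
open import Function using (_∘_; id)
open import Relation.Binary.PropositionalEquality using (_≡_; refl; sym; trans; cong; cong₂)

-- Equality of functions is pointwise, so the
-- functor is required to respect pointwise-equal functions (F-cong); this holds
-- for every functor on Set under function extensionality.
record SetFunctor : Set₁ where
  field
    F₀    : Set → Set
    F₁    : {A B : Set} → (A → B) → F₀ A → F₀ B
    F-id  : {A : Set} (x : F₀ A) → F₁ (id {A = A}) x ≡ x
    F-∘   : {A B C : Set} (f : A → B) (g : B → C) (x : F₀ A) →
            F₁ (g ∘ f) x ≡ F₁ g (F₁ f x)
    F-cong : {A B : Set} {f g : A → B} → (∀ a → f a ≡ g a) →
             (x : F₀ A) → F₁ f x ≡ F₁ g x
open SetFunctor public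

pmap : {A B C D : Set} → (A → C) → (B → D) → A × B → C × D
pmap f g (a , b) = f a , g b

record DistLaw (FS FR FSR : SetFunctor) : Set₁ where
  field
    comp    : (X Y : Set) → F₀ FS X × F₀ FR Y → F₀ FSR (X × Y)
    natural : {X X′ Y Y′ : Set} (f : X → X′) (g : Y → Y′)
              (z : F₀ FS X × F₀ FR Y) →
              F₁ FSR (pmap f g) (comp X Y z) ≡ comp X′ Y′ (pmap (F₁ FS f) (F₁ FR g) z)
open DistLaw public

record SliceObj (Ω : Set) : Set₁ where
  constructor sobj
  field
    Dom : Set
    arr : Dom → Ω
open SliceObj public

record SliceHom {Ω : Set} (a b : SliceObj Ω) : Set where
  constructor shom
  field
    fun  : Dom a → Dom b
    comm : (x : Dom a) → arr b (fun x) ≡ arr a x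
open SliceHom public

p₀ : {Ω : Set} → SliceObj Ω → Set
p₀ = Dom

p₁ : {Ω : Set} {a b : SliceObj Ω} → SliceHom a b → Dom a → Dom b
p₁ = fun

liftObj : (F : SetFunctor) {Ω : Set} → (F₀ F Ω → Ω) → SliceObj Ω → SliceObj Ω
liftObj F τ u = sobj (F₀ F (Dom u)) (τ ∘ F₁ F (arr u))

liftHom : (F : SetFunctor) {Ω : Set} (τ : F₀ F Ω → Ω) {u v : SliceObj Ω} →
          SliceHom u v → SliceHom (liftObj F τ u) (liftObj F τ v)
liftHom F τ {u} {v} h =
  shom (F₁ F (fun h))
       (λ x → cong τ (trans (sym (F-∘ F (fun h) (arr v) x)) (F-cong F (comm h) x)))

×̃Obj : {ΩS ΩR : Set} → SliceObj ΩS → SliceObj ΩR → SliceObj (ΩS × ΩR)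
×̃Obj u v = sobj (Dom u × Dom v) (pmap (arr u) (arr v))

×̃Hom : {ΩS ΩR : Set} {u u′ : SliceObj ΩS} {v v′ : SliceObj ΩR} →
       SliceHom u u′ → SliceHom v v′ → SliceHom (×̃Obj u v) (×̃Obj u′ v′)
×̃Hom h k = shom (pmap (fun h) (fun k)) (λ { (a , b) → cong₂ _,_ (comm h a) (comm k b) })

q̃Obj : {ΩS ΩR ΩSR : Set} → (ΩS × ΩR → ΩSR) → SliceObj (ΩS × ΩR) → SliceObj ΩSR
q̃Obj q u = sobj (Dom u) (q ∘ arr u)

q̃Hom : {ΩS ΩR ΩSR : Set} (q : ΩS × ΩR → ΩSR) {u v : SliceObj (ΩS × ΩR)} →
       SliceHom u v → SliceHom (q̃Obj q u) (q̃Obj q v)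
q̃Hom q h = shom (fun h) (λ x → cong q (comm h x))

module Lifted (FS FR FSR : SetFunctor) {ΩS ΩR ΩSR : Set}
              (τS : F₀ FS ΩS → ΩS) (τR : F₀ FR ΩR → ΩR) (τSR : F₀ FSR ΩSR → ΩSR)
              (q : ΩS × ΩR → ΩSR) where

  SrcObj : SliceObj ΩS → SliceObj ΩR → SliceObj ΩSR
  SrcObj u v = q̃Obj q (×̃Obj (liftObj FS τS u) (liftObj FR τR v))

  SrcHom : {u u′ : SliceObj ΩS} {v v′ : SliceObj ΩR} →
           SliceHom u u′ → SliceHom v v′ → SliceHom (SrcObj u v) (SrcObj u′ v′)
  SrcHom h k = q̃Hom q (×̃Hom (liftHom FS τS h) (liftHom FR τR k))

  TgtObj : SliceObj ΩS → SliceObj ΩR → SliceObj ΩSR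
  TgtObj u v = liftObj FSR τSR (q̃Obj q (×̃Obj u v))

  TgtHom : {u u′ : SliceObj ΩS} {v v′ : SliceObj ΩR} →
           SliceHom u u′ → SliceHom v v′ → SliceHom (TgtObj u v) (TgtObj u′ v′)
  TgtHom h k = liftHom FSR τSR (q̃Hom q (×̃Hom h k))

  -- A natural transformation Src ⇒ Tgt (equality of slice morphisms is
  -- pointwise equality of underlying functions).
  record NatTrans : Set₁ where
    field
      η       : (u : SliceObj ΩS) (v : SliceObj ΩR) → SliceHom (SrcObj u v) (TgtObj u v)
      natural : {u u′ : SliceObj ΩS} {v v′ : SliceObj ΩR}
                (h : SliceHom u u′) (k : SliceHom v v′) (z : Dom (SrcObj u v)) →
                fun (TgtHom h k) (fun (η u v) z) ≡ fun (η u′ v′) (fun (SrcHom h k) z)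
  open NatTrans public

{-# OPTIONS --safe #-}
-- The lifting is λ itself. Over (u_S, u_R), λ_{X,Y} is a slice morphism by naturality
-- of λ at (u_S, u_R) followed by the compatibility of q; naturality of the lifting is
-- that of λ, since all lifted functors act on morphisms as the underlying ones.
module Submission where

open import Defs
open import Data.Product using (_×_; _,_; Σ)
open import Function using (_∘_)
open import Relation.Binary.PropositionalEquality using (_≡_; refl; sym; cong; module ≡-Reasoning)

module LiftedDistLaw (FS FR FSR : SetFunctor) {ΩS ΩR ΩSR : Set}
  (τS : F₀ FS ΩS → ΩS) (τR : F₀ FR ΩR → ΩR) (τSR : F₀ FSR ΩSR → ΩSR)
  (λ′ : DistLaw FS FR FSR) (q : ΩS × ΩR → ΩSR)
  (q-compatible : (z : F₀ FS ΩS × F₀ FR ΩR) →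
                  q (pmap τS τR z) ≡ τSR (F₁ FSR q (comp λ′ ΩS ΩR z)))
  where

  open Lifted FS FR FSR τS τR τSR q

  comp-isSliceHom : (u : SliceObj ΩS) (v : SliceObj ΩR) (z : Dom (SrcObj u v)) →
                    arr (TgtObj u v) (comp λ′ (Dom u) (Dom v) z) ≡ arr (SrcObj u v) z
  comp-isSliceHom u v (a , b) = begin
    τSR (F₁ FSR (q ∘ pmap (arr u) (arr v)) (comp λ′ (Dom u) (Dom v) (a , b)))
      ≡⟨ cong τSR (F-∘ FSR (pmap (arr u) (arr v)) q _) ⟩
    τSR (F₁ FSR q (F₁ FSR (pmap (arr u) (arr v)) (comp λ′ (Dom u) (Dom v) (a , b))))
      ≡⟨ cong (τSR ∘ F₁ FSR q) (natural λ′ (arr u) (arr v) (a , b)) ⟩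
    τSR (F₁ FSR q (comp λ′ ΩS ΩR (F₁ FS (arr u) a , F₁ FR (arr v) b)))
      ≡⟨ sym (q-compatible (F₁ FS (arr u) a , F₁ FR (arr v) b)) ⟩
    q (τS (F₁ FS (arr u) a) , τR (F₁ FR (arr v) b))
      ∎
    where open ≡-Reasoning

  λ̃ : NatTrans
  λ̃ = record
    { η       = λ u v → shom (comp λ′ (Dom u) (Dom v)) (comp-isSliceHom u v)
    ; natural = λ h k → natural λ′ (fun h) (fun k)
    }

propositionC4 : (FS FR FSR : SetFunctor) {ΩS ΩR ΩSR : Set}
    (τS : F₀ FS ΩS → ΩS) (τR : F₀ FR ΩR → ΩR) (τSR : F₀ FSR ΩSR → ΩSR)
    (λ′ : DistLaw FS FR FSR) (q : ΩS × ΩR → ΩSR) →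
    ((z : F₀ FS ΩS × F₀ FR ΩR) →
      q (pmap τS τR z) ≡ τSR (F₁ FSR q (comp λ′ ΩS ΩR z))) →
    Σ (Lifted.NatTrans FS FR FSR τS τR τSR q) λ λ̃ →
      (u : SliceObj ΩS) (v : SliceObj ΩR) (z : F₀ FS (Dom u) × F₀ FR (Dom v)) →
        p₁ (Lifted.η λ̃ u v) z ≡ comp λ′ (Dom u) (Dom v) z
propositionC4 FS FR FSR τS τR τSR λ′ q q-compatible =
  LiftedDistLaw.λ̃ FS FR FSR τS τR τSR λ′ q q-compatible , λ _ _ _ → refl
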